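{- For every $k\ge2$ there is a graph $G$ with $\mathrm{ctdw}(G)\le2$ and $\mathrm{cstw}(G)\ge k$.
   Context: A strong tree decomposition of $G=(V,E)$ is $(\{X_i\}_{i\in I},T=(I,F))$ where $\{X_i\}$ partitions $V$ and $T$ is a tree such that each edge has both ends in one bag or in bags of two adjacent tree nodes; its width is the maximum bag size. $\mathrm{cstw}(G)$ (connected strong tree width) is the minimum width of a strong tree decomposition in which each bag induces a connected subgraph. A tree distance decomposition is a strong tree decomposition with root $r$ such that each $v\in X_i$, $i\neq r$, has a neighbor in the bag of the parent of $i$; $\mathrm{ctdw}(G)$ (root-connected tree distance width) is the minimum width of a tree distance decomposition whose root bag induces a connected subgraph. -}

module Defs where

open import Level using (0ℓ)
open import Data.Nat using (ℕ; suc; _≤_; _≥_)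
open import Data.Fin using (Fin)
open import Data.Fin.Properties using (_≟_)
open import Data.List using (List; []; _∷_; length; filter)
open import Data.List.Relation.Unary.All using (All)
open import Data.List.Relation.Unary.Unique.Propositional using (Unique)
open import Data.List.Membership.Propositional using (_∉_)
open import Data.List.Base using () renaming (allFin to allFinL)
open import Data.Product using (Σ; ∃; ∃-syntax; _×_)
open import Data.Sum using (_⊎_)
open import Relation.Nullary using (¬_)
open import Relation.Binary.PropositionalEquality using (_≡_; _≢_)

record Graph : Set₁ where
  field
    n      : ℕ
    Adj    : Fin n → Fin n → Set
    sym    : ∀ {u v} → Adj u v → Adj v u
    irrefl : ∀ {v} → ¬ Adj v v
open Graph public

data Path {X : Set} (A : X → X → Set) : X → X → List X → Set where
  here : ∀ x → Path A x x (x ∷ [])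
  step : ∀ {x y z vs} → A x y → Path A y z vs → Path A x z (x ∷ vs)

InducesConnected : (G : Graph) → (Fin (n G) → Set) → Set
InducesConnected G S =
  ∀ u v → S u → S v → ∃[ vs ] (Path (Adj G) u v vs × All S vs)

Connected : Graph → Set
Connected G = InducesConnected G (λ _ → Data.Unit.⊤)
  where import Data.Unit

Acyclic : Graph → Set
Acyclic G = ∀ x y vs → Adj G x y → Path (Adj G) y x vs → Unique vs → 3 ≤ length vs → Data.Empty.⊥
  where import Data.Empty

IsTree : Graph → Set
IsTree T = (1 ≤ n T) × Connected T × Acyclic T

-- Strong tree decomposition: bags given by the map  bag : V(G) → V(T),
-- X_i = { v | bag v ≡ i }; the bags partition V(G) (each bag nonempty).
record StrongTD (G : Graph) : Set₁ where
  field
    T        : Graph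
    isTree   : IsTree T
    bag      : Fin (n G) → Fin (n T)
    nonempty : ∀ i → ∃[ v ] (bag v ≡ i)
    edges    : ∀ {u v} → Adj G u v → bag u ≡ bag v ⊎ Adj T (bag u) (bag v)

  bagSize : Fin (n T) → ℕ
  bagSize i = length (filter (λ v → bag v ≟ i) (allFinL (n G)))

  BagConnected : Fin (n T) → Set
  BagConnected i = InducesConnected G (λ v → bag v ≡ i)
open StrongTD public

WidthAtMost : ∀ {G} → StrongTD G → ℕ → Set
WidthAtMost D w = ∀ i → bagSize D i ≤ w

WidthAtLeast : ∀ {G} → StrongTD G → ℕ → Set
WidthAtLeast D w = ∃[ i ] (w ≤ bagSize D i)

IsParent : (T : Graph) → (r i j : Fin (n T)) → Set
IsParent T r i j = Adj T i j × ∃[ vs ] (Path (Adj T) j r vs × Unique vs × i ∉ vs)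

IsTreeDistanceDecomp : ∀ {G} → (D : StrongTD G) → Fin (n (T D)) → Set
IsTreeDistanceDecomp {G} D r =
  ∀ v → bag D v ≢ r →
    ∃[ u ] (Adj G v u × IsParent (T D) r (bag D v) (bag D u))

ctdw≤ : Graph → ℕ → Set₁
ctdw≤ G w = Σ (StrongTD G) λ D → ∃[ r ]
  (IsTreeDistanceDecomp D r × BagConnected D r × WidthAtMost D w)

cstw≥ : Graph → ℕ → Set₁
cstw≥ G w = (D : StrongTD G) → (∀ i → BagConnected D i) → WidthAtLeast D w

-- The witness is the cycle C of length 2k.
--
-- Upper bound: the bags {0}, {1, 2k-1}, {2, 2k-2}, …, {k} are the distance layers
-- from vertex 0; they form a tree distance decomposition over a path with root {0}.
--
-- Lower bound: connected bags of C are arcs, so if some edge p–(p+1) joins two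
-- different bags, walking once around C from p+1 to p meets the bags along a simple
-- path of the tree that starts at the bag of p+1 and ends at the bag of p.  These two
-- bags are adjacent in the tree, so acyclicity forces the path to have at most two
-- vertices.  Hence C lies in at most two bags and one of them has at least k vertices.
module Submission where

open import Defs
open import Data.Empty using (⊥; ⊥-elim)
open import Data.Fin as Fin using (Fin; zero; suc; toℕ; fromℕ; fromℕ<; inject₁)
open import Data.Fin.Induction using (<-weakInduction)
open import Data.Fin.Properties
  using (toℕ-injective; toℕ<n; toℕ-fromℕ; toℕ-fromℕ<; toℕ-inject₁; ≤fromℕ;
         fromℕ≢inject₁; i≤inject₁[j]⇒i≤1+j; all?; ¬∀⟶∃¬; _≟_)
open import Data.Fin.Relation.Unary.Top using (view; ‵fromℕ; ‵inject₁)
open import Data.List using (List; []; _∷_; length; filter; map; allFin)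
open import Data.List.Membership.Propositional using (_∈_)
open import Data.List.Properties using (length-map; length-tabulate)
open import Data.List.Relation.Unary.All as All using (All; []; _∷_)
open import Data.List.Relation.Unary.All.Properties using (all-filter) renaming (map⁺ to All-map⁺)
open import Data.List.Relation.Unary.Any using (here; there)
open import Data.List.Relation.Unary.AllPairs using ([]; _∷_)
open import Data.List.Relation.Unary.Unique.Propositional using (Unique)
open import Data.List.Relation.Unary.Unique.Propositional.Properties using (filter⁺; allFin⁺)
  renaming (map⁺ to Unique-map⁺)
open import Data.Nat as ℕ using (ℕ; zero; suc; _+_; _∸_; _≤_; _<_; _≥_; _≤?_; z≤n; s≤s; NonZero)
import Data.Nat.Properties as ℕ
open import Data.Nat.DivMod using (_%_; _mod_; m%n<n; %-distribˡ-+; m%n%n≡m%n; [m+n]%n≡m%n; m<n⇒m%n≡m; n%n≡0)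
open import Data.Product using (Σ; ∃-syntax; ∃₂; _×_; _,_; proj₁; proj₂; map₂) renaming (swap to ×-swap)
open import Data.Sum using (_⊎_; inj₁; inj₂; [_,_]; swap) renaming (map₂ to ⊎-map₂)
open import Data.Unit using (tt)
open import Function using (id; _∘_)
open import Relation.Nullary using (¬_; Dec; yes; no; contradiction)
open import Relation.Unary using (Decidable)
open import Relation.Binary.PropositionalEquality as ≡
  using (_≡_; _≢_; refl; trans; cong; subst; subst₂; module ≡-Reasoning)

open ≡-Reasoning

UnitStep : ℕ → ℕ → Set
UnitStep m n = suc m ≡ n ⊎ suc n ≡ m

UnitStep-sym : ∀ {m n} → UnitStep m n → UnitStep n m
UnitStep-sym = swap

UnitStep-irrefl : ∀ {m} → ¬ UnitStep m m
UnitStep-irrefl (inj₁ e) = ℕ.1+n≢n e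
UnitStep-irrefl (inj₂ e) = ℕ.1+n≢n e

Between : ℕ → ℕ → ℕ → Set
Between w a b = (a ≤ w × w ≤ b) ⊎ (b ≤ w × w ≤ a)

Between-degenerate : ∀ {w a} → Between w a a → a ≡ w
Between-degenerate (inj₁ (a≤w , w≤a)) = ℕ.≤-antisym a≤w w≤a
Between-degenerate (inj₂ (a≤w , w≤a)) = ℕ.≤-antisym a≤w w≤a

Between-step : ∀ {w a b c} → Between w a c → a ≢ w → UnitStep a b → Between w b c
Between-step (inj₁ (a≤w , w≤c)) a≢w (inj₁ refl) = inj₁ (ℕ.≤∧≢⇒< a≤w a≢w , w≤c)
Between-step (inj₁ (a≤w , w≤c)) _   (inj₂ refl) = inj₁ (ℕ.≤-trans (ℕ.n≤1+n _) a≤w , w≤c)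
Between-step (inj₂ (c≤w , w≤a)) _   (inj₁ refl) = inj₂ (c≤w , ℕ.m≤n⇒m≤1+n w≤a)
Between-step (inj₂ (c≤w , w≤a)) a≢w (inj₂ refl) =
  inj₂ (c≤w , ℕ.≤-pred (ℕ.≤∧≢⇒< w≤a (a≢w ∘ ≡.sym)))

UnitStep-straddle : ∀ {a b c} → UnitStep b a → UnitStep b c → a ≢ c → Between b a c
UnitStep-straddle (inj₁ refl) (inj₁ refl) a≢c = contradiction refl a≢c
UnitStep-straddle (inj₁ refl) (inj₂ refl) _   = inj₂ (ℕ.n≤1+n _ , ℕ.n≤1+n _)
UnitStep-straddle (inj₂ refl) (inj₁ refl) _   = inj₁ (ℕ.n≤1+n _ , ℕ.n≤1+n _)
UnitStep-straddle (inj₂ refl) (inj₂ refl) a≢c = contradiction refl a≢c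

k+k≤m+n⇒k≤m⊎k≤n : ∀ k m n → k + k ≤ m + n → k ≤ m ⊎ k ≤ n
k+k≤m+n⇒k≤m⊎k≤n k m n k+k≤m+n with k ≤? m | k ≤? n
... | yes k≤m | _       = inj₁ k≤m
... | no _    | yes k≤n = inj₂ k≤n
... | no k≰m  | no k≰n  = contradiction k+k≤m+n (ℕ.<⇒≱ (ℕ.+-mono-< (ℕ.≰⇒> k≰m) (ℕ.≰⇒> k≰n)))

[m+n%d]%d≡[m+n]%d : ∀ m n d .{{_ : NonZero d}} → (m + n % d) % d ≡ (m + n) % d
[m+n%d]%d≡[m+n]%d m n d = begin
  (m + n % d) % d         ≡⟨ %-distribˡ-+ m (n % d) d ⟩
  (m % d + n % d % d) % d ≡⟨ cong (λ r → (m % d + r) % d) (m%n%n≡m%n n d) ⟩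
  (m % d + n % d) % d     ≡⟨ %-distribˡ-+ m n d ⟨
  (m + n) % d             ∎

i≤1+j⇒i≡1+j⊎i≤inject₁[j] : ∀ {m} {i : Fin (suc m)} {j : Fin m} →
                            i Fin.≤ suc j → i ≡ suc j ⊎ i Fin.≤ inject₁ j
i≤1+j⇒i≡1+j⊎i≤inject₁[j] {j = j} i≤1+j with ℕ.m≤n⇒m<n∨m≡n i≤1+j
... | inj₁ i<1+j = inj₂ (subst (_ ≤_) (≡.sym (toℕ-inject₁ j)) (ℕ.≤-pred i<1+j))
... | inj₂ i≡1+j = inj₁ (toℕ-injective i≡1+j)

1+i≰inject₁[i] : ∀ {m} (i : Fin m) → ¬ (suc i Fin.≤ inject₁ i)
1+i≰inject₁[i] i le = ℕ.1+n≰n (subst (suc (toℕ i) ≤_) (toℕ-inject₁ i) le)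

length≤1 : ∀ {A : Set} {p : A} {xs} → Unique xs → All (_≡ p) xs → length xs ≤ 1
length≤1 []             []                 = z≤n
length≤1 (_ ∷ [])       (_ ∷ [])           = s≤s z≤n
length≤1 ((x≢y ∷ _) ∷ _) (refl ∷ refl ∷ _) = contradiction refl x≢y

≢⇒≡-other : ∀ {A : Set} {x y q : A} → x ≢ y → y ≡ x ⊎ y ≡ q → y ≡ q
≢⇒≡-other x≢y = [ (λ y≡x → contradiction (≡.sym y≡x) x≢y) , id ]

length≤2 : ∀ {A : Set} {p q : A} {xs} → Unique xs → All (λ x → x ≡ p ⊎ x ≡ q) xs → length xs ≤ 2
length≤2 []            []                   = z≤n
length≤2 (x≢xs ∷ uniq) (inj₁ refl ∷ xs∈pq) =
  s≤s (length≤1 uniq (All.zipWith (λ (x≢y , y∈pq) → ≢⇒≡-other x≢y y∈pq) (x≢xs , xs∈pq)))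
length≤2 (x≢xs ∷ uniq) (inj₂ refl ∷ xs∈pq) =
  s≤s (length≤1 uniq (All.zipWith (λ (x≢y , y∈pq) → ≢⇒≡-other x≢y (swap y∈pq)) (x≢xs , xs∈pq)))

length≤filter+filter : ∀ {A : Set} {P Q : A → Set} (P? : Decidable P) (Q? : Decidable Q) xs →
                       (∀ x → P x ⊎ Q x) → length xs ≤ length (filter P? xs) + length (filter Q? xs)
length≤filter+filter P? Q? []       _     = z≤n
length≤filter+filter P? Q? (x ∷ xs) cover with P? x | Q? x | length≤filter+filter P? Q? xs cover
... | yes _  | yes _  | ih = s≤s (ℕ.≤-trans ih (ℕ.+-monoʳ-≤ _ (ℕ.n≤1+n _)))
... | yes _  | no _   | ih = s≤s ih
... | no _   | yes _  | ih = subst (suc (length xs) ≤_) (≡.sym (ℕ.+-suc _ _)) (s≤s ih)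
... | no ¬px | no ¬qx | _  = ⊥-elim ([ ¬px , ¬qx ] (cover x))

module _ {X : Set} {A : X → X → Set} where

  Path-head∈ : ∀ {x z vs} → Path A x z vs → x ∈ vs
  Path-head∈ (here _)   = here refl
  Path-head∈ (step _ _) = here refl

  Path-last∈ : ∀ {x z vs} → Path A x z vs → z ∈ vs
  Path-last∈ (here _)   = here refl
  Path-last∈ (step _ p) = there (Path-last∈ p)

  Path-++ : ∀ {x y z vs ws} → Path A x y vs → Path A y z ws → ∃[ us ] Path A x z us
  Path-++ (here _)   q = _ , q
  Path-++ (step a p) q = let us , r = Path-++ p q in _ ∷ us , step a r

  Path-reverse : (∀ {a b} → A a b → A b a) → ∀ {x z vs} → Path A x z vs → ∃[ ws ] Path A z x ws
  Path-reverse _   (here x)   = _ , here x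
  Path-reverse sym (step a p) = Path-++ (proj₂ (Path-reverse sym p)) (step (sym a) (here _))

  Path-short⇒endpoint : ∀ {x z vs y} → Path A x z vs → length vs ≤ 2 → y ∈ vs → y ≡ x ⊎ y ≡ z
  Path-short⇒endpoint (here _)                  _                 (here y≡x)         = inj₁ y≡x
  Path-short⇒endpoint (step _ _)                _                 (here y≡x)         = inj₁ y≡x
  Path-short⇒endpoint (step _ (here _))         _                 (there (here y≡z)) = inj₂ y≡z
  Path-short⇒endpoint (step _ (step _ (here _)))   (s≤s (s≤s ())) _
  Path-short⇒endpoint (step _ (step _ (step _ _))) (s≤s (s≤s ())) _

Path-map : ∀ {X Y : Set} {A : X → X → Set} {B : Y → Y → Set} (f : X → Y) →
           (∀ {u v} → A u v → B (f u) (f v)) →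
           ∀ {x z vs} → Path A x z vs → Path B (f x) (f z) (map f vs)
Path-map f f-adj (here x)   = here (f x)
Path-map f f-adj (step a p) = step (f-adj a) (Path-map f f-adj p)

-- A discrete intermediate value theorem: a walk along which f moves by unit steps,
-- except across W-edges, takes every value between its end values or uses a W-edge.
module _ {X : Set} {A : X → X → Set} (W : X → X → Set) (f : X → ℕ)
         (classify : ∀ {x y} → A x y → UnitStep (f x) (f y) ⊎ W x y) where

  Path-crosses : ∀ {x z vs} w → Path A x z vs → Between w (f x) (f z) →
                 (∃[ a ] (a ∈ vs × f a ≡ w)) ⊎ (∃₂ λ a b → a ∈ vs × b ∈ vs × W a b)
  Path-crosses w (here x) between = inj₁ (x , here refl , Between-degenerate between)
  Path-crosses w (step {x} a p) between with f x ℕ.≟ w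
  ... | yes fx≡w = inj₁ (x , here refl , fx≡w)
  ... | no fx≢w with classify a
  ...   | inj₂ wxy  = inj₂ (x , _ , here refl , there (Path-head∈ p) , wxy)
  ...   | inj₁ unit with Path-crosses w p (Between-step between fx≢w unit)
  ...     | inj₁ (b , b∈ , fb≡w)          = inj₁ (b , there b∈ , fb≡w)
  ...     | inj₂ (b , b′ , b∈ , b′∈ , wbb′) = inj₂ (b , b′ , there b∈ , there b′∈ , wbb′)

unitStep⇒acyclic : (G : Graph) (f : Fin (n G) → ℕ) → (∀ {x y} → f x ≡ f y → x ≡ y) →
                   (∀ {x y} → Adj G x y → UnitStep (f x) (f y)) → Acyclic G
unitStep⇒acyclic G f f-inj unit x y _ _   (here _)                  _ (s≤s ())
unitStep⇒acyclic G f f-inj unit x y _ _   (step _ (here _))         _ (s≤s (s≤s ()))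
unitStep⇒acyclic G f f-inj unit x y _ x~y (step y~y₂ p@(step _ p′)) (y∉ ∷ y₂∉ ∷ _) _
  with Path-crosses (λ _ _ → ⊥) f (λ a → inj₁ (unit a)) (f y) p (UnitStep-straddle (unit y~y₂) (unit (sym G x~y)) fy₂≢fx)
  where fy₂≢fx = λ e → All.lookup y₂∉ (Path-last∈ p′) (f-inj e)
... | inj₁ (a , a∈ , fa≡fy) = All.lookup y∉ a∈ (f-inj (≡.sym fa≡fy))
... | inj₂ (_ , _ , _ , _ , ())

connected-via-root : (G : Graph) (r : Fin (n G)) → (∀ v → ∃[ vs ] Path (Adj G) v r vs) → Connected G
connected-via-root G r to-root u v _ _ =
  _ , proj₂ (Path-++ (proj₂ (to-root u)) (proj₂ (Path-reverse (sym G) (proj₂ (to-root v))))) ,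
  All.universal (λ _ → tt) _

record Automorphism (G : Graph) : Set where
  field
    to       : Fin (n G) → Fin (n G)
    from     : Fin (n G) → Fin (n G)
    from-to  : ∀ v → from (to v) ≡ v
    to-from  : ∀ v → to (from v) ≡ v
    to-adj   : ∀ {u v} → Adj G u v → Adj G (to u) (to v)
    from-adj : ∀ {u v} → Adj G u v → Adj G (from u) (from v)

module _ {G : Graph} (φ : Automorphism G) where
  open Automorphism φ

  InducesConnected-pullback : ∀ {S} → InducesConnected G S → InducesConnected G (S ∘ to)
  InducesConnected-pullback {S} connected u v Su Sv with connected (to u) (to v) Su Sv
  ... | vs , path , inS =
    map from vs ,
    subst₂ (λ x y → Path (Adj G) x y (map from vs)) (from-to u) (from-to v) (Path-map from from-adj path) ,
    All-map⁺ (All.map (λ {w} Sw → subst S (≡.sym (to-from w)) Sw) inS)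

  precompose : StrongTD G → StrongTD G
  precompose D = record
    { T        = T D
    ; isTree   = isTree D
    ; bag      = bag D ∘ to
    ; nonempty = λ i → let (v , bag≡i) = nonempty D i in from v , trans (cong (bag D) (to-from v)) bag≡i
    ; edges    = edges D ∘ to-adj
    }

  precompose-connected : ∀ D → (∀ i → BagConnected D i) → ∀ i → BagConnected (precompose D) i
  precompose-connected D connected i = InducesConnected-pullback (connected i)

module PathGraph (L : ℕ) where

  P : Graph
  P = record
    { n      = suc L
    ; Adj    = λ i j → UnitStep (toℕ i) (toℕ j)
    ; sym    = UnitStep-sym
    ; irrefl = UnitStep-irrefl
    }

  Descent : Fin (suc L) → Set
  Descent i = ∃[ vs ] (Path (Adj P) i zero vs × Unique vs × All (Fin._≤ i) vs)

  descent : ∀ i → Descent i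
  descent = <-weakInduction Descent (zero ∷ [] , here zero , [] ∷ [] , z≤n ∷ []) extend
    where
    extend : ∀ i → Descent (inject₁ i) → Descent (suc i)
    extend i (vs , path , uniq , below) =
      suc i ∷ vs ,
      step (inj₂ (cong suc (toℕ-inject₁ i))) path ,
      All.map (λ { a≤i refl → 1+i≰inject₁[i] i a≤i }) below ∷ uniq ,
      ℕ.≤-refl ∷ All.map i≤inject₁[j]⇒i≤1+j below

  P-isTree : IsTree P
  P-isTree = s≤s z≤n ,
             connected-via-root P zero (λ v → map₂ proj₁ (descent v)) ,
             unitStep⇒acyclic P toℕ toℕ-injective id

  P-parent : ∀ i j → suc (toℕ j) ≡ toℕ i → IsParent P zero i j
  P-parent i j 1+j≡i with descent j
  ... | vs , path , uniq , below =
    inj₂ 1+j≡i , vs , path , uniq ,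
    λ i∈ → ℕ.1+n≰n (subst (_≤ toℕ j) (≡.sym 1+j≡i) (All.lookup below i∈))

module Cycle (M : ℕ) where

  N : ℕ
  N = suc (suc M)

  last : Fin N
  last = fromℕ (suc M)

  rotate : ℕ → Fin N → Fin N
  rotate s u = (s + toℕ u) mod N

  toℕ-rotate : ∀ s u → toℕ (rotate s u) ≡ (s + toℕ u) % N
  toℕ-rotate s u = toℕ-fromℕ< (m%n<n (s + toℕ u) N)

  rotate-rotate : ∀ t s u → rotate t (rotate s u) ≡ rotate (t + s) u
  rotate-rotate t s u = toℕ-injective (begin
    toℕ (rotate t (rotate s u)) ≡⟨ toℕ-rotate t (rotate s u) ⟩
    (t + toℕ (rotate s u)) % N  ≡⟨ cong (λ r → (t + r) % N) (toℕ-rotate s u) ⟩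
    (t + (s + toℕ u) % N) % N   ≡⟨ [m+n%d]%d≡[m+n]%d t (s + toℕ u) N ⟩
    (t + (s + toℕ u)) % N       ≡⟨ cong (_% N) (ℕ.+-assoc t s (toℕ u)) ⟨
    (t + s + toℕ u) % N         ≡⟨ toℕ-rotate (t + s) u ⟨
    toℕ (rotate (t + s) u)      ∎)

  rotate-N : ∀ u → rotate N u ≡ u
  rotate-N u = toℕ-injective (begin
    toℕ (rotate N u)  ≡⟨ toℕ-rotate N u ⟩
    (N + toℕ u) % N   ≡⟨ cong (_% N) (ℕ.+-comm N (toℕ u)) ⟩
    (toℕ u + N) % N   ≡⟨ [m+n]%n≡m%n (toℕ u) N ⟩
    toℕ u % N         ≡⟨ m<n⇒m%n≡m (toℕ<n u) ⟩
    toℕ u             ∎)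

  next : Fin N → Fin N
  next = rotate 1

  rotate-next : ∀ s u → rotate s (next u) ≡ next (rotate s u)
  rotate-next s u = begin
    rotate s (rotate 1 u) ≡⟨ rotate-rotate s 1 u ⟩
    rotate (s + 1) u      ≡⟨ cong (λ t → rotate t u) (ℕ.+-comm s 1) ⟩
    rotate (1 + s) u      ≡⟨ rotate-rotate 1 s u ⟨
    rotate 1 (rotate s u) ∎

  next-inject₁ : ∀ i → next (inject₁ i) ≡ suc i
  next-inject₁ i = toℕ-injective (begin
    toℕ (next (inject₁ i))  ≡⟨ toℕ-rotate 1 (inject₁ i) ⟩
    suc (toℕ (inject₁ i)) % N ≡⟨ cong (λ r → suc r % N) (toℕ-inject₁ i) ⟩
    suc (toℕ i) % N         ≡⟨ m<n⇒m%n≡m (s≤s (toℕ<n i)) ⟩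
    suc (toℕ i)             ∎)

  next-last : next last ≡ zero
  next-last = toℕ-injective (begin
    toℕ (next last)      ≡⟨ toℕ-rotate 1 last ⟩
    suc (toℕ last) % N   ≡⟨ cong (λ r → suc r % N) (toℕ-fromℕ (suc M)) ⟩
    N % N                ≡⟨ n%n≡0 N ⟩
    0                    ∎)

  next-kind : ∀ u → suc (toℕ u) ≡ toℕ (next u) ⊎ (u ≡ last × next u ≡ zero)
  next-kind u with view u
  ... | ‵fromℕ     = inj₂ (refl , next-last)
  ... | ‵inject₁ i = inj₁ (trans (cong suc (toℕ-inject₁ i)) (cong toℕ (≡.sym (next-inject₁ i))))

  next-irrefl : ∀ u → u ≢ next u
  next-irrefl u u≡next with next-kind u
  ... | inj₁ 1+u≡next = ℕ.1+n≢n (trans 1+u≡next (cong toℕ (≡.sym u≡next)))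
  ... | inj₂ (refl , e) = fromℕ≢inject₁ {i = zero} (trans u≡next e)

  C : Graph
  C = record
    { n      = N
    ; Adj    = λ u v → v ≡ next u ⊎ u ≡ next v
    ; sym    = swap
    ; irrefl = λ where (inj₁ e) → next-irrefl _ e
                       (inj₂ e) → next-irrefl _ e
    }

  rotate-adj : ∀ s {u v} → Adj C u v → Adj C (rotate s u) (rotate s v)
  rotate-adj s (inj₁ refl) = inj₁ (rotate-next s _)
  rotate-adj s (inj₂ refl) = inj₂ (rotate-next s _)

  rotation : ∀ s → s ≤ N → Automorphism C
  rotation s s≤N = record
    { to       = rotate s
    ; from     = rotate (N ∸ s)
    ; from-to  = λ u → trans (rotate-rotate (N ∸ s) s u)
                         (trans (cong (λ t → rotate t u) (ℕ.m∸n+n≡m s≤N)) (rotate-N u))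
    ; to-from  = λ u → trans (rotate-rotate s (N ∸ s) u)
                         (trans (cong (λ t → rotate t u) (ℕ.m+[n∸m]≡n s≤N)) (rotate-N u))
    ; to-adj   = rotate-adj s
    ; from-adj = rotate-adj (N ∸ s)
    }

  rotate-last : ∀ p → rotate (suc (toℕ p)) last ≡ p
  rotate-last p = toℕ-injective (begin
    toℕ (rotate (suc (toℕ p)) last) ≡⟨ toℕ-rotate (suc (toℕ p)) last ⟩
    (suc (toℕ p) + toℕ last) % N    ≡⟨ cong (λ r → (suc (toℕ p) + r) % N) (toℕ-fromℕ (suc M)) ⟩
    (suc (toℕ p) + suc M) % N       ≡⟨ cong (_% N) (ℕ.+-suc (toℕ p) (suc M)) ⟨
    (toℕ p + N) % N                 ≡⟨ [m+n]%n≡m%n (toℕ p) N ⟩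
    toℕ p % N                       ≡⟨ m<n⇒m%n≡m (toℕ<n p) ⟩
    toℕ p                           ∎)

  rotate-zero : ∀ p → rotate (suc (toℕ p)) zero ≡ next p
  rotate-zero p = begin
    rotate (suc (toℕ p)) zero        ≡⟨ cong (rotate (suc (toℕ p))) next-last ⟨
    rotate (suc (toℕ p)) (next last) ≡⟨ rotate-next (suc (toℕ p)) last ⟩
    next (rotate (suc (toℕ p)) last) ≡⟨ cong next (rotate-last p) ⟩
    next p                           ∎

  Wrap : Fin N → Fin N → Set
  Wrap u v = (u ≡ last × v ≡ zero) ⊎ (u ≡ zero × v ≡ last)

  edge-kind : ∀ {u v} → Adj C u v → UnitStep (toℕ u) (toℕ v) ⊎ Wrap u v
  edge-kind {u}     (inj₁ refl) with next-kind u
  ... | inj₁ e = inj₁ (inj₁ e)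
  ... | inj₂ w = inj₂ (inj₁ w)
  edge-kind {v = v} (inj₂ refl) with next-kind v
  ... | inj₁ e = inj₁ (inj₂ e)
  ... | inj₂ w = inj₂ (inj₂ (×-swap w))

  cycle-path-crosses : ∀ {x z vs} w → Path (Adj C) x z vs → toℕ x ≤ w → w ≤ toℕ z →
                       (∃[ a ] (a ∈ vs × toℕ a ≡ w)) ⊎ (zero ∈ vs × last ∈ vs)
  cycle-path-crosses w path x≤w w≤z =
    ⊎-map₂ wrap-ends (Path-crosses Wrap toℕ edge-kind w path (inj₁ (x≤w , w≤z)))
    where
    wrap-ends : ∀ {vs} → ∃₂ (λ a b → a ∈ vs × b ∈ vs × Wrap a b) → zero ∈ vs × last ∈ vs
    wrap-ends (_ , _ , a∈ , b∈ , inj₁ (refl , refl)) = b∈ , a∈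
    wrap-ends (_ , _ , a∈ , b∈ , inj₂ (refl , refl)) = a∈ , b∈

  module SeparatedEnds (D : StrongTD C) (connected : ∀ B → BagConnected D B)
                       (separated : bag D zero ≢ bag D last) where

    c : Fin N → Fin (n (T D))
    c = bag D

    tree-edge : ∀ {u v} → Adj C u v → c u ≢ c v → Adj (T D) (c u) (c v)
    tree-edge u~v c≢ with edges D u~v
    ... | inj₁ same = contradiction same c≢
    ... | inj₂ adj  = adj

    -- A bag met again after leaving it would be an arc through the cut edge last–zero.
    bag-change-is-new : ∀ i a → a Fin.≤ inject₁ i → c (suc i) ≢ c (inject₁ i) → c (suc i) ≢ c a
    bag-change-is-new i a a≤i changed same
      with connected (c a) a (suc i) refl same
    ... | vs , path , inBag
      with cycle-path-crosses (toℕ i) path (subst (_ ≤_) (toℕ-inject₁ i) a≤i) (ℕ.n≤1+n (toℕ i))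
    ... | inj₁ (b , b∈ , b≡i) =
      changed (trans same (≡.sym (trans (cong c (≡.sym b≡inject₁i)) (All.lookup inBag b∈))))
      where b≡inject₁i = toℕ-injective (trans b≡i (≡.sym (toℕ-inject₁ i)))
    ... | inj₂ (zero∈ , last∈) = separated (trans (All.lookup inBag zero∈) (≡.sym (All.lookup inBag last∈)))

    record Trail (i : Fin N) : Set where
      field
        bags     : List (Fin (n (T D)))
        path     : Path (Adj (T D)) (c i) (c zero) bags
        unique   : Unique bags
        sound    : All (λ B → ∃[ a ] (a Fin.≤ i × c a ≡ B)) bags
        complete : ∀ a → a Fin.≤ i → c a ∈ bags

    trail-zero : Trail zero
    trail-zero = record
      { bags     = c zero ∷ []
      ; path     = here (c zero)
      ; unique   = [] ∷ []
      ; sound    = (zero , z≤n , refl) ∷ []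
      ; complete = λ a a≤0 → here (cong c (toℕ-injective (ℕ.n≤0⇒n≡0 a≤0)))
      }

    trail-suc : ∀ i → Trail (inject₁ i) → Trail (suc i)
    trail-suc i tr = extend (c (suc i) ≟ c (inject₁ i))
      where
      open Trail tr

      sound-suc : ∀ {bs} → All (λ B → ∃[ a ] (a Fin.≤ inject₁ i × c a ≡ B)) bs →
                  All (λ B → ∃[ a ] (a Fin.≤ suc i × c a ≡ B)) bs
      sound-suc = All.map (λ (a , a≤i , e) → a , i≤inject₁[j]⇒i≤1+j a≤i , e)

      complete-suc : ∀ {bs} → c (suc i) ∈ bs → (∀ {B} → B ∈ bags → B ∈ bs) →
                     ∀ a → a Fin.≤ suc i → c a ∈ bs
      complete-suc head∈ grow a a≤1+i with i≤1+j⇒i≡1+j⊎i≤inject₁[j] a≤1+i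
      ... | inj₁ refl = head∈
      ... | inj₂ a≤i  = grow (complete a a≤i)

      extend : Dec (c (suc i) ≡ c (inject₁ i)) → Trail (suc i)
      extend (yes same) = record
        { bags     = bags
        ; path     = subst (λ B → Path (Adj (T D)) B (c zero) bags) (≡.sym same) path
        ; unique   = unique
        ; sound    = sound-suc sound
        ; complete = complete-suc (subst (_∈ bags) (≡.sym same) (Path-head∈ path)) id
        }
      extend (no changed) = record
        { bags     = c (suc i) ∷ bags
        ; path     = step (tree-edge (inj₂ (≡.sym (next-inject₁ i))) changed) path
        ; unique   = All.map (λ (a , a≤i , e) same → bag-change-is-new i a a≤i changed (trans same (≡.sym e)))
                             sound ∷ unique
        ; sound    = (suc i , ℕ.≤-refl , refl) ∷ sound-suc sound
        ; complete = complete-suc (here refl) there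
        }

    module Full = Trail (<-weakInduction Trail trail-zero trail-suc last)

    bag-dichotomy : ∀ v → c v ≡ c last ⊎ c v ≡ c zero
    bag-dichotomy v with 3 ≤? length Full.bags
    ... | yes long = ⊥-elim (proj₂ (proj₂ (isTree D)) (c zero) (c last) Full.bags
                               (tree-edge (inj₂ (≡.sym next-last)) separated) Full.path Full.unique long)
    ... | no short = Path-short⇒endpoint Full.path (ℕ.≤-pred (ℕ.≰⇒> short)) (Full.complete v (≤fromℕ v))

  constant-bag : (D : StrongTD C) → (∀ p → bag D p ≡ bag D (next p)) → ∀ v → bag D v ≡ bag D zero
  constant-bag D uncut = <-weakInduction (λ v → bag D v ≡ bag D zero) refl
    (λ i ih → trans (cong (bag D) (≡.sym (next-inject₁ i))) (trans (≡.sym (uncut (inject₁ i))) ih))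

  at-most-two-bags : (D : StrongTD C) → (∀ B → BagConnected D B) →
                     ∃₂ λ B B′ → ∀ v → bag D v ≡ B ⊎ bag D v ≡ B′
  at-most-two-bags D connected with all? (λ p → bag D p ≟ bag D (next p))
  ... | yes uncut = bag D zero , bag D zero , inj₁ ∘ constant-bag D uncut
  ... | no cut with ¬∀⟶∃¬ N (λ p → bag D p ≡ bag D (next p)) (λ p → bag D p ≟ bag D (next p)) cut
  ... | p , p-cut =
    bag D p , bag D (next p) ,
    λ v → subst (λ w → bag D w ≡ bag D p ⊎ bag D w ≡ bag D (next p)) (to-from v) (dichotomy (from v))
    where
    ρ = rotation (suc (toℕ p)) (toℕ<n p)
    open Automorphism ρ
    D′ = precompose ρ D

    separated : bag D′ zero ≢ bag D′ last
    separated e = p-cut (≡.sym (subst₂ _≡_ (cong (bag D) (rotate-zero p)) (cong (bag D) (rotate-last p)) e))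

    dichotomy : ∀ u → bag D (to u) ≡ bag D p ⊎ bag D (to u) ≡ bag D (next p)
    dichotomy u = subst₂ (λ B B′ → bag D (to u) ≡ B ⊎ bag D (to u) ≡ B′)
                    (cong (bag D) (rotate-last p)) (cong (bag D) (rotate-zero p))
                    (SeparatedEnds.bag-dichotomy D′ (precompose-connected ρ D connected) separated u)

  covering-bags-size : ∀ (D : StrongTD C) {B B′} → (∀ v → bag D v ≡ B ⊎ bag D v ≡ B′) →
                       N ≤ bagSize D B + bagSize D B′
  covering-bags-size D {B} {B′} covered =
    subst (_≤ bagSize D B + bagSize D B′) (length-tabulate id)
      (length≤filter+filter (λ v → bag D v ≟ B) (λ v → bag D v ≟ B′) (allFin N) covered)

  cycle-cstw≥ : ∀ K → K + K ≤ N → cstw≥ C K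
  cycle-cstw≥ K K+K≤N D connected with at-most-two-bags D connected
  ... | B , B′ , covered
    with k+k≤m+n⇒k≤m⊎k≤n K _ _ (ℕ.≤-trans K+K≤N (covering-bags-size D covered))
  ... | inj₁ K≤|B|  = B , K≤|B|
  ... | inj₂ K≤|B′| = B′ , K≤|B′|

-- fold a is the distance from 0 to a on a cycle of length K + K.
module Fold (K : ℕ) where

  fold : ℕ → ℕ
  fold a with a ≤? K
  ... | yes _ = a
  ... | no  _ = K + K ∸ a

  fold-≤ : ∀ {a} → a ≤ K → fold a ≡ a
  fold-≤ {a} a≤K with a ≤? K
  ... | yes _   = refl
  ... | no a≰K  = contradiction a≤K a≰K

  fold-≥ : ∀ {a} → K ≤ a → fold a ≡ K + K ∸ a
  fold-≥ {a} K≤a with a ≤? K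
  ... | yes a≤K = subst (λ x → x ≡ K + K ∸ x) (ℕ.≤-antisym K≤a a≤K) (≡.sym (ℕ.m+n∸n≡m K K))
  ... | no _    = refl

  fold≤K : ∀ a → fold a ≤ K
  fold≤K a with a ≤? K
  ... | yes a≤K = a≤K
  ... | no  a≰K = subst (K + K ∸ a ≤_) (ℕ.m+n∸n≡m K K) (ℕ.∸-monoʳ-≤ (K + K) (ℕ.<⇒≤ (ℕ.≰⇒> a≰K)))

  fold≡0⇒≡0 : ∀ {a} → a < K + K → fold a ≡ 0 → a ≡ 0
  fold≡0⇒≡0 {a} a<K+K e with a ≤? K
  ... | yes _ = e
  ... | no  _ = contradiction (ℕ.m∸n≡0⇒m≤n e) (ℕ.<⇒≱ a<K+K)

  fold-fibre : ∀ {a} → a ≤ K + K → a ≡ fold a ⊎ a ≡ K + K ∸ fold a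
  fold-fibre {a} a≤K+K with a ≤? K
  ... | yes _ = inj₁ refl
  ... | no  _ = inj₂ (≡.sym (ℕ.m∸[m∸n]≡n a≤K+K))

  fold-K+K : fold (K + K) ≡ 0
  fold-K+K = trans (fold-≥ (ℕ.m≤m+n K K)) (ℕ.n∸n≡0 (K + K))

  fold-suc-≤ : ∀ {a} → suc a ≤ K → fold (suc a) ≡ suc (fold a)
  fold-suc-≤ 1+a≤K = trans (fold-≤ 1+a≤K) (cong suc (≡.sym (fold-≤ (ℕ.<⇒≤ 1+a≤K))))

  fold-suc-≥ : ∀ {a} → K ≤ a → suc a ≤ K + K → suc (fold (suc a)) ≡ fold a
  fold-suc-≥ {a} K≤a 1+a≤K+K = begin
    suc (fold (suc a))   ≡⟨ cong suc (fold-≥ (ℕ.m≤n⇒m≤1+n K≤a)) ⟩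
    suc (K + K ∸ suc a)  ≡⟨ ℕ.+-∸-assoc 1 1+a≤K+K ⟨
    K + K ∸ a            ≡⟨ fold-≥ K≤a ⟨
    fold a               ∎

  fold-unitStep : ∀ a → suc a ≤ K + K → UnitStep (fold a) (fold (suc a))
  fold-unitStep a 1+a≤K+K = by-side (suc a ≤? K)
    where
    by-side : Dec (suc a ≤ K) → UnitStep (fold a) (fold (suc a))
    by-side (yes 1+a≤K) = inj₁ (≡.sym (fold-suc-≤ 1+a≤K))
    by-side (no  1+a≰K) = inj₂ (fold-suc-≥ (ℕ.≤-pred (ℕ.≰⇒> 1+a≰K)) 1+a≤K+K)

module EvenCycle (j : ℕ) where

  K : ℕ
  K = suc (suc j)

  open Cycle (j + K)
  open Fold K
  open PathGraph K

  fold-next : ∀ u → fold (toℕ (next u)) ≡ fold (suc (toℕ u))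
  fold-next u with next-kind u
  ... | inj₁ e          = cong fold (≡.sym e)
  ... | inj₂ (refl , e) = begin
    fold (toℕ (next last)) ≡⟨ cong (fold ∘ toℕ) e ⟩
    fold 0                 ≡⟨ fold-≤ z≤n ⟩
    0                      ≡⟨ fold-K+K ⟨
    fold (K + K)           ≡⟨ cong (fold ∘ suc) (toℕ-fromℕ (suc (j + K))) ⟨
    fold (suc (toℕ last))  ∎

  fold-next-step : ∀ u → UnitStep (fold (toℕ u)) (fold (toℕ (next u)))
  fold-next-step u = subst (UnitStep (fold (toℕ u))) (≡.sym (fold-next u)) (fold-unitStep (toℕ u) (toℕ<n u))

  fold-adj : ∀ {u v} → Adj C u v → UnitStep (fold (toℕ u)) (fold (toℕ v))
  fold-adj {u}     (inj₁ refl) = fold-next-step u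
  fold-adj {v = v} (inj₂ refl) = UnitStep-sym (fold-next-step v)

  fold-parent : ∀ v → fold (toℕ v) ≢ 0 → ∃[ u ] (Adj C v u × suc (fold (toℕ u)) ≡ fold (toℕ v))
  fold-parent v = by-side v (toℕ v ≤? K)
    where
    by-side : ∀ v → Dec (toℕ v ≤ K) → fold (toℕ v) ≢ 0 → ∃[ u ] (Adj C v u × suc (fold (toℕ u)) ≡ fold (toℕ v))
    by-side zero    _           fold≢0 = contradiction (fold-≤ z≤n) fold≢0
    by-side (suc i) (yes 1+i≤K) _      =
      inject₁ i , inj₂ (≡.sym (next-inject₁ i)) ,
      trans (cong (suc ∘ fold) (toℕ-inject₁ i)) (≡.sym (fold-suc-≤ 1+i≤K))
    by-side v       (no v≰K)    _      =
      next v , inj₁ refl , trans (cong suc (fold-next v)) (fold-suc-≥ (ℕ.<⇒≤ (ℕ.≰⇒> v≰K)) (toℕ<n v))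

  layer : Fin N → Fin (suc K)
  layer v = fromℕ< (s≤s (fold≤K (toℕ v)))

  toℕ-layer : ∀ v → toℕ (layer v) ≡ fold (toℕ v)
  toℕ-layer v = toℕ-fromℕ< (s≤s (fold≤K (toℕ v)))

  layer-surjective : ∀ i → ∃[ v ] (layer v ≡ i)
  layer-surjective i = v , toℕ-injective (begin
    toℕ (layer v)      ≡⟨ toℕ-layer v ⟩
    fold (toℕ v)       ≡⟨ cong fold (toℕ-fromℕ< i<N) ⟩
    fold (toℕ i)       ≡⟨ fold-≤ (ℕ.≤-pred (toℕ<n i)) ⟩
    toℕ i              ∎)
    where
    i<N : toℕ i < N
    i<N = ℕ.≤-trans (toℕ<n i) (ℕ.m<m+n K (s≤s z≤n))
    v = fromℕ< i<N

  layer-adj : ∀ {u v} → Adj C u v → Adj P (layer u) (layer v)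
  layer-adj {u} {v} u~v = subst₂ UnitStep (≡.sym (toℕ-layer u)) (≡.sym (toℕ-layer v)) (fold-adj u~v)

  D : StrongTD C
  D = record
    { T        = P
    ; isTree   = P-isTree
    ; bag      = layer
    ; nonempty = layer-surjective
    ; edges    = inj₂ ∘ layer-adj
    }

  distance-decomposition : IsTreeDistanceDecomp D zero
  distance-decomposition v layer≢0
    with fold-parent v (layer≢0 ∘ toℕ-injective ∘ trans (toℕ-layer v))
  ... | u , v~u , parent =
    u , v~u , P-parent (layer v) (layer u)
                (trans (cong suc (toℕ-layer u)) (trans parent (≡.sym (toℕ-layer v))))

  layer≡0⇒≡0 : ∀ v → layer v ≡ zero → v ≡ zero
  layer≡0⇒≡0 v e = toℕ-injective (fold≡0⇒≡0 (toℕ<n v) (trans (≡.sym (toℕ-layer v)) (cong toℕ e)))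

  root-connected : BagConnected D zero
  root-connected u v layer-u layer-v with layer≡0⇒≡0 u layer-u | layer≡0⇒≡0 v layer-v
  ... | refl | refl = zero ∷ [] , here zero , layer-u ∷ []

  width≤2 : WidthAtMost D 2
  width≤2 i = subst (_≤ 2) (length-map toℕ members)
    (length≤2 (Unique-map⁺ toℕ-injective (filter⁺ inBag? (allFin⁺ N)))
              (All-map⁺ (All.map member-value (all-filter inBag? (allFin N)))))
    where
    inBag? = λ v → layer v ≟ i
    members = filter inBag? (allFin N)
    member-value : ∀ {v} → layer v ≡ i → toℕ v ≡ toℕ i ⊎ toℕ v ≡ K + K ∸ toℕ i
    member-value {v} e = subst (λ d → toℕ v ≡ d ⊎ toℕ v ≡ K + K ∸ d)
                           (trans (≡.sym (toℕ-layer v)) (cong toℕ e)) (fold-fibre (ℕ.<⇒≤ (toℕ<n v)))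

  ctdw≤2 : ctdw≤ C 2
  ctdw≤2 = D , zero , distance-decomposition , root-connected , width≤2

theorem8 : (k : ℕ) → k ≥ 2 → Σ Graph (λ G → ctdw≤ G 2 × cstw≥ G k)
theorem8 (suc (suc j)) (s≤s (s≤s z≤n)) = C , ctdw≤2 , cycle-cstw≥ (suc (suc j)) ℕ.≤-refl
  where
  open Cycle (j + suc (suc j))
  open EvenCycle j
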